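{- Let $n\ge 3$, let $G=K(p_1,p_2,\ldots,p_n)$ be a complete $n$-partite graph with partite sets $V_1,\ldots,V_n$, and let $D$ be an orientation of $G$. Suppose there exist indices $i\neq j$ with $1\le i,j\le n$ and vertices $u\in V_i$, $w\in V_j$ such that $$O(u)\cap (V(G)-V_j)=O(w)\cap (V(G)-V_i).$$ Then $d(D)\ge 3$.
   Context: $K(p_1,\ldots,p_n)$ denotes the complete $n$-partite graph whose $i$-th partite set $V_i$ has $p_i$ vertices. An orientation of a graph $G$ is a digraph obtained by giving each edge of $G$ a direction. For a digraph $D$ and vertex $v$, the outset is $O(v)=\{x: v\to x\}$. The distance $d_D(u,v)$ is the length of a shortest directed $u$–$v$ path ($\infty$ if none exists), and the diameter $d(D)$ is the maximum of $d_D(u,v)$ over all ordered pairs of vertices. -}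

module Defs where

open import Data.Nat using (ℕ; zero; suc; _≤_)
open import Data.Fin using (Fin)
open import Data.Bool using (Bool; true; false; not)
open import Data.Product using (Σ; ∃; _×_; proj₁)
open import Relation.Binary.PropositionalEquality using (_≡_; _≢_)
open import Relation.Nullary using (¬_)

-- Vertex set of the complete n-partite graph K(p_1,...,p_n):
-- a vertex is a pair (k , a) with k the index of its partite set V_k
-- and a : Fin (p k) a vertex within V_k.
Vertex : (n : ℕ) → (Fin n → ℕ) → Set
Vertex n p = Σ (Fin n) (λ k → Fin (p k))

part : {n : ℕ} {p : Fin n → ℕ} → Vertex n p → Fin n
part = proj₁

Digraph : (n : ℕ) → (Fin n → ℕ) → Set
Digraph n p = Vertex n p → Vertex n p → Bool

record IsOrientation {n : ℕ} {p : Fin n → ℕ} (D : Digraph n p) : Set where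
  field
    noArcInPart : ∀ x y → part x ≡ part y → D x y ≡ false
    oneDirection : ∀ x y → part x ≢ part y → D x y ≡ not (D y x)

data Walk {n : ℕ} {p : Fin n → ℕ} (D : Digraph n p) :
          Vertex n p → Vertex n p → ℕ → Set where
  here : ∀ {x} → Walk D x x zero
  step : ∀ {x y z m} → D x y ≡ true → Walk D y z m → Walk D x z (suc m)

-- d_D(x , y) ≤ k  (a shortest directed path has length ≤ k iff some walk does).
DistLE : {n : ℕ} {p : Fin n → ℕ} → Digraph n p → Vertex n p → Vertex n p → ℕ → Set
DistLE D x y k = ∃ λ m → m ≤ k × Walk D x y m

-- d(D) ≥ k+1 : some ordered pair has distance > k (possibly ∞).
DiamGT : {n : ℕ} {p : Fin n → ℕ} → Digraph n p → ℕ → Set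
DiamGT D k = ∃ λ x → ∃ λ y → ¬ DistLE D x y k

-- If u → w, then every out-neighbour x of w outside V_i is, by the hypothesis,
-- also an out-neighbour of u; so a walk w → x → u would put both u → x and
-- x → u in D, and w → u is excluded by u → w. Hence d(w, u) ≥ 3. If instead
-- w → u, the same argument with the roles exchanged gives d(u, w) ≥ 3.
module Submission where

open import Defs
open import Data.Nat using (ℕ; _≤_; s≤s)
open import Data.Fin using (Fin)
open import Data.Bool using (true; false; not)
open import Data.Product using (_×_; _,_; proj₁)
open import Function.Bundles using (_⇔_; Equivalence)
open import Relation.Binary.PropositionalEquality using (_≡_; _≢_; refl; sym; trans; cong)
open import Relation.Nullary using (¬_)

module _ {n : ℕ} {p : Fin n → ℕ} {D : Digraph n p} (O : IsOrientation D) where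
  open IsOrientation O

  arc⇒part≢ : ∀ {x y} → D x y ≡ true → part x ≢ part y
  arc⇒part≢ {x} {y} xy e with () ← trans (sym xy) (noArcInPart x y e)

  arc⇒¬reverse : ∀ {x y} → D x y ≡ true → D y x ≢ true
  arc⇒¬reverse {x} {y} xy yx
    with () ← trans (sym yx) (trans (oneDirection y x (arc⇒part≢ yx)) (cong not xy))

  ¬arc⇒reverse : ∀ {x y} → part x ≢ part y → D x y ≡ false → D y x ≡ true
  ¬arc⇒reverse {x} {y} x≢y xy = trans (oneDirection y x (λ e → x≢y (sym e))) (cong not xy)

  OutCovers : Vertex n p → Vertex n p → Set
  OutCovers a b = ∀ x → D b x ≡ true → part x ≢ part a → D a x ≡ true

  arc∧OutCovers⇒¬DistLE2 : ∀ {a b} → D a b ≡ true → OutCovers a b → ¬ DistLE D b a 2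
  arc∧OutCovers⇒¬DistLE2 ab cover (_ , _ , here) = arc⇒part≢ ab refl
  arc∧OutCovers⇒¬DistLE2 ab cover (_ , _ , step ba here) = arc⇒¬reverse ab ba
  arc∧OutCovers⇒¬DistLE2 ab cover (_ , _ , step {y = x} bx (step xa here)) =
    arc⇒¬reverse xa (cover x bx (arc⇒part≢ xa))
  arc∧OutCovers⇒¬DistLE2 ab cover (_ , s≤s (s≤s ()) , step _ (step _ (step _ _)))

lemma2p1 : (n : ℕ) → 3 ≤ n → (p : Fin n → ℕ) → (∀ k → 1 ≤ p k) →
    (D : Digraph n p) → IsOrientation D →
    (i j : Fin n) → i ≢ j → (u w : Vertex n p) → part u ≡ i → part w ≡ j →
    (∀ x → ((D u x ≡ true × part x ≢ j) ⇔ (D w x ≡ true × part x ≢ i))) →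
    DiamGT D 2
lemma2p1 n _ p _ D O i j i≢j u w refl refl outsets≡ with D u w in uw
... | true  = w , u , arc∧OutCovers⇒¬DistLE2 O uw u-covers-w
  where
  u-covers-w : OutCovers O u w
  u-covers-w x wx x≢i = proj₁ (Equivalence.from (outsets≡ x) (wx , x≢i))
... | false = u , w , arc∧OutCovers⇒¬DistLE2 O (¬arc⇒reverse O i≢j uw) w-covers-u
  where
  w-covers-u : OutCovers O w u
  w-covers-u x ux x≢j = proj₁ (Equivalence.to (outsets≡ x) (ux , x≢j))
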